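{- Let $G=R(m;a,b,c)$ be a connected generalized rose window graph, let $H$ be the graph obtained from $G$ by removing all spokes of type $c$, and let $H_0$ be the connected component of $H$ containing $u_0$. Assume $\gcd(m,a,b)>1$. If $H_0$ has a $2$-hooked Hamilton cycle, then $G$ is hamiltonian.
   Context: For $m\ge3$ and $a,b,c\in\mathbb{Z}_m\setminus\{0\}$ with $a,b\ne m/2$, the generalized rose window graph $R(m;a,b,c)$ has vertices $u_i,v_i$ ($i\in\mathbb{Z}_m$) and edges $u_iu_{i+a}$ (outer edges), $v_iv_{i+b}$ (inner edges), $u_iv_i$ (spokes of type $0$) and $u_iv_{i+c}$ (spokes of type $c$), for $i\in\mathbb{Z}_m$. The component $H_0$ has vertex set $\{u_x,v_x : x\in\Lambda\}$ where $\Lambda$ is the subgroup of $\mathbb{Z}_m$ generated by $a$ and $b$, with edges $u_xu_{x+a}$, $v_xv_{x+b}$, $u_xv_x$. A Hamilton cycle of $H_0$ is alternating if every maximal subpath of outer edges and every maximal subpath of inner edges has exactly one edge, and non-alternating otherwise. For $t\in\Lambda$, re-indexing by $t$ means renaming each $u_x,v_x$ as $u_{x+t},v_{x+t}$. A Hamilton cycle $C$ provides a Hamilton path $P$ if $P$ can be obtained from $C$ by replacing one or more edges of $C$ by edges of $H_0$ not in $C$. A non-alternating Hamilton cycle $C$ of $H_0$ is $2$-hooked if, after re-indexing by some $t\in\Lambda$, $C$ provides a Hamilton path of $H_0$ from $v_0$ to $v_a$ or from $u_0$ to $u_b$. -}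

module Defs where

open import Data.Nat using (ℕ; zero; suc; _+_; _∸_; _≤_)
open import Data.Nat.DivMod using (_mod_)
open import Data.Fin using (Fin; toℕ; fromℕ; inject₁)
open import Data.Fin.Subset using (Subset; Nonempty; _∉_)
open import Data.Product using (Σ; ∃; _×_; _,_; proj₁; proj₂)
open import Data.Sum using (_⊎_)
open import Data.Unit using (⊤)
open import Relation.Nullary using (¬_)
open import Relation.Binary.PropositionalEquality using (_≡_; _≢_)
open import Relation.Binary.Construct.Closure.ReflexiveTransitive using (Star)
open import Function.Definitions using (Injective)

-- Arithmetic in ℤ_m, represented by Fin m (residues 0,…,m-1).
-- The first argument of toZ only witnesses that m ≠ 0.

toZ : ∀ {m} → Fin m → ℕ → Fin m
toZ {suc k} _ n = n mod suc k

zeroZ : ∀ {m} → Fin m → Fin m    -- the residue 0 (argument only witnesses m ≠ 0)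
zeroZ x = toZ x 0

_⊕_ : ∀ {m} → Fin m → Fin m → Fin m
x ⊕ y = toZ x (toℕ x + toℕ y)

⊖_ : ∀ {m} → Fin m → Fin m
⊖_ {m} x = toZ x (m ∸ toℕ x)

data Λ {m : ℕ} (a b : Fin m) : Fin m → Set where
  gen-a   : Λ a b a
  gen-b   : Λ a b b
  gen-0   : Λ a b (zeroZ a)
  gen-add : ∀ {x y} → Λ a b x → Λ a b y → Λ a b (x ⊕ y)
  gen-neg : ∀ {x} → Λ a b x → Λ a b (⊖ x)

data V (m : ℕ) : Set where
  u : Fin m → V m
  v : Fin m → V m

data GEdge {m : ℕ} (a b c : Fin m) : V m → V m → Set where
  outer  : ∀ i → GEdge a b c (u i) (u (i ⊕ a))
  inner  : ∀ i → GEdge a b c (v i) (v (i ⊕ b))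
  spoke0 : ∀ i → GEdge a b c (u i) (v i)
  spokec : ∀ i → GEdge a b c (u i) (v (i ⊕ c))

GAdj : ∀ {m} (a b c : Fin m) → V m → V m → Set
GAdj a b c x y = GEdge a b c x y ⊎ GEdge a b c y x

index : ∀ {m} → V m → Fin m
index (u i) = i
index (v i) = i

InH0 : ∀ {m} (a b : Fin m) → V m → Set
InH0 a b x = Λ a b (index x)

data H0Edge {m : ℕ} (a b : Fin m) : V m → V m → Set where
  outer : ∀ {x} → Λ a b x → H0Edge a b (u x) (u (x ⊕ a))
  inner : ∀ {x} → Λ a b x → H0Edge a b (v x) (v (x ⊕ b))
  spoke : ∀ {x} → Λ a b x → H0Edge a b (u x) (v x)

H0Adj : ∀ {m} (a b : Fin m) → V m → V m → Set
H0Adj a b x y = H0Edge a b x y ⊎ H0Edge a b y x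

csuc : ∀ {n} → Fin n → Fin n
csuc i = toZ i (suc (toℕ i))

record HamCycle {m : ℕ} (P : V m → Set) (Adj : V m → V m → Set) : Set where
  field
    len   : ℕ
    len≥3 : 3 ≤ len
    w     : Fin len → V m
    inj   : Injective _≡_ _≡_ w
    inP   : ∀ i → P (w i)
    cover : ∀ x → P x → ∃ λ i → w i ≡ x
    adj   : ∀ i → Adj (w i) (w (csuc i))

record HamPath {m : ℕ} (P : V m → Set) (Adj : V m → V m → Set) (s t : V m) : Set where
  field
    k     : ℕ                      -- number of edges; vertices are w 0 … w k
    w     : Fin (suc k) → V m
    inj   : Injective _≡_ _≡_ w
    inP   : ∀ i → P (w i)
    cover : ∀ x → P x → ∃ λ i → w i ≡ x
    adj   : ∀ (i : Fin k) → Adj (w (inject₁ i)) (w (Fin.suc i))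
    start : w Fin.zero ≡ s
    end   : w (fromℕ k) ≡ t

Hamiltonian : ∀ {m} → (V m → V m → Set) → Set
Hamiltonian Adj = HamCycle (λ _ → ⊤) Adj

Connected : ∀ {m} → (V m → V m → Set) → Set
Connected {m} Adj = ∀ (x y : V m) → Star Adj x y

SameEdge : ∀ {m} → V m × V m → V m × V m → Set
SameEdge (p , q) (r , s) = (p ≡ r × q ≡ s) ⊎ (p ≡ s × q ≡ r)

cedge : ∀ {m n} → (Fin n → V m) → Fin n → V m × V m
cedge w i = (w i , w (csuc i))

pedge : ∀ {m k} → (Fin (suc k) → V m) → Fin k → V m × V m
pedge w i = (w (inject₁ i) , w (Fin.suc i))

data Kind : Set where
  outerK innerK spokeK : Kind

kind : ∀ {m} → V m × V m → Kind
kind (u _ , u _) = outerK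
kind (v _ , v _) = innerK
kind (u _ , v _) = spokeK
kind (v _ , u _) = spokeK

-- some maximal run of outer edges or of inner edges has ≥ 2 edges, i.e.
-- two cyclically consecutive edges are both outer or both inner.
NonAlternating : ∀ {m} {P : V m → Set} {Adj : V m → V m → Set} → HamCycle P Adj → Set
NonAlternating C =
  ∃ λ i → kind (cedge w i) ≡ kind (cedge w (csuc i)) × kind (cedge w i) ≢ spokeK
  where open HamCycle C

shift : ∀ {m} → Fin m → V m → V m
shift t (u x) = u (x ⊕ t)
shift t (v x) = v (x ⊕ t)

-- The cyclic sequence wc (of length n) "provides" the Hamilton path P of H_0:
-- P is obtained from wc by removing a nonempty set R of edges of wc and
-- adding edges of H_0 not in wc.
Provides : ∀ {m} (a b : Fin m) {s t : V m} (n : ℕ) (wc : Fin n → V m) →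
           HamPath (InH0 a b) (H0Adj a b) s t → Set
Provides a b n wc Pth =
  Σ (Subset n) λ R →
    Nonempty R
    × (∀ j → (∃ λ i → i ∉ R × SameEdge (pedge w j) (cedge wc i))
           ⊎ (H0Adj a b (proj₁ (pedge w j)) (proj₂ (pedge w j))
              × ¬ (∃ λ i → SameEdge (pedge w j) (cedge wc i))))
    × (∀ i → i ∉ R → ∃ λ j → SameEdge (cedge wc i) (pedge w j))
  where open HamPath Pth

TwoHooked : ∀ {m} (a b : Fin m) → HamCycle (InH0 a b) (H0Adj a b) → Set
TwoHooked a b C =
  NonAlternating C ×
  ∃ λ t → Λ a b t ×
    ((Σ (HamPath (InH0 a b) (H0Adj a b) (v (zeroZ a)) (v a)) λ P →
         Provides a b len (λ i → shift t (w i)) P)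
     ⊎ (Σ (HamPath (InH0 a b) (H0Adj a b) (u (zeroZ a)) (u b)) λ P →
         Provides a b len (λ i → shift t (w i)) P))
  where open HamCycle C

{-# OPTIONS --safe #-}
module Submission where

-- Let Λ = ⟨a, b⟩ ≤ ℤ_m and let ℓ + 1 be the order of c modulo Λ. The translates H₀ + j c
-- (j = 0, …, ℓ) of H₀ are pairwise disjoint, consecutive ones are joined by spokes of type c, and
-- since G is connected they cover G. The map u_i ↔ v_i is an isomorphism R(m;a,b,c) ≅ R(m;b,a,−c)
-- exchanging the two kinds of hooks, so we may assume that H₀ has a Hamilton path P from v₀ to v_a.
-- A vertex u_x has only one spoke in H₀, so a Hamilton cycle or path of H₀ passing through u_x uses
-- an outer edge u_y u_{y+a} next to it. Replacing that edge by u_y → v_{y+c} ⇝ v_{y+c+a} → u_{y+a},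
-- where the middle part is P translated by y + c, absorbs the next translate. Starting from the
-- Hamilton cycle of H₀ and repeating this inside each inserted copy of P reaches all ℓ + 1 translates.

open import Defs
open import Algebra.Bundles using (AbelianGroup)
open import Algebra.Consequences.Propositional using (comm∧idˡ⇒id; comm∧invʳ⇒inv)
open import Algebra.Structures using (IsAbelianGroup)
import Algebra.Properties.AbelianGroup as AbelianGroupProperties
import Algebra.Properties.CommutativeSemigroup as CommutativeSemigroupProperties
import Algebra.Properties.Monoid.Mult as MonoidMultiplication
open import Data.Nat using (ℕ; zero; suc; _+_; _*_; _∸_; _≤_; _<_; _%_; _/_; s≤s)
open import Data.Nat.DivMod
  using (_mod_; %-distribˡ-+; m%n%n≡m%n; m<n⇒m%n≡m; n%n≡0; m*n%n≡0; m≡m%n+[m/n]*n; m%n<n)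
open import Data.Nat.GCD using (gcd)
open import Data.Nat.Properties
  using ( +-comm; +-assoc; *-comm; *-assoc; *-suc; *-identityˡ; +-suc; +-identityʳ; <⇒≤; ≤-pred; ≤-refl; ≤-trans
        ; n<1+n; m<n⇒m<1+n; m+[n∸m]≡n; m≤n⇒∃[o]m+o≡n; m+n≤o⇒m≤o; m+n≤o⇒n≤o)
open import Data.Fin using (Fin; toℕ; fromℕ; fromℕ<; inject₁) renaming (zero to fzero; suc to fsuc)
open import Data.Fin.Properties
  using ( toℕ-injective; toℕ-fromℕ<; toℕ-fromℕ; toℕ-inject; toℕ-inject₁; toℕ<n; injective⇒≤
        ; any?; _≟_; ¬∀⟶∃¬-smallest)
open import Data.List using (List; []; _∷_; _++_; [_]; map; reverse; tabulate; length; lookup)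
open import Data.List.Properties using (unfold-reverse; ++-assoc; map-++)
open import Data.List.Membership.Propositional using (_∈_)
open import Data.List.Membership.Propositional.Properties
  using (∈-++⁺ˡ; ∈-++⁺ʳ; ∈-++⁻; ∈-map⁺; ∈-map⁻; ∈-tabulate⁺; ∈-tabulate⁻; ∈-lookup)
open import Data.List.Relation.Unary.Any using (here; there)
import Data.List.Relation.Unary.Any as Any
open import Data.List.Relation.Unary.Any.Properties using (lookup-index)
open import Data.List.Relation.Unary.All using (_∷_)
open import Data.List.Relation.Unary.All.Properties using (All¬⇒¬Any)
open import Data.List.Relation.Unary.AllPairs using (_∷_)
open import Data.List.Relation.Unary.Unique.Propositional using (Unique)
import Data.List.Relation.Unary.Unique.Propositional.Properties as Unique
open import Data.List.Relation.Binary.Permutation.Propositional using (_↭_; ↭-sym; ↭⇒↭ₛ; prep)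
open import Data.List.Relation.Binary.Permutation.Propositional.Properties
  using (∈-resp-↭; ↭-reverse; ++⁺ˡ; ++-comm)
import Data.List.Relation.Binary.Permutation.Setoid.Properties as PermutationSetoid
open import Data.Product using (∃; ∃₂; _×_; _,_; proj₁; proj₂)
open import Data.Sum using (_⊎_; inj₁; inj₂; [_,_]′; swap) renaming (map to map⊎)
open import Data.Empty using (⊥; ⊥-elim)
open import Data.Unit using (⊤)
open import Function using (_∘′_; id)
open import Function.Definitions using (Injective)
open import Level using (0ℓ)
open import Relation.Binary.PropositionalEquality hiding ([_])
open import Relation.Binary.PropositionalEquality.Properties using (setoid)
open import Relation.Binary.PropositionalEquality.Algebra using (isMagma)
open import Relation.Binary.Construct.Closure.ReflexiveTransitive using (Star; fold; gmap)
open import Relation.Nullary using (¬_)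
open import Relation.Nullary.Decidable using (map′; decidable-stable; ¬?)
open import Relation.Unary using (Pred; Decidable; _∪_; _≐_)

-- Enumerations and walks

record Enumerates {A : Set} (P : Pred A 0ℓ) (xs : List A) : Set where
  field
    unique   : Unique xs
    sound    : ∀ {x} → x ∈ xs → P x
    complete : ∀ {x} → P x → x ∈ xs

open Enumerates public

module _ {A : Set} where

  Enumerates-resp-↭ : ∀ {P : Pred A 0ℓ} {xs ys} → xs ↭ ys → Enumerates P xs → Enumerates P ys
  Enumerates-resp-↭ xs↭ys e = record
    { unique   = PermutationSetoid.Unique-resp-↭ (setoid A) (↭⇒↭ₛ xs↭ys) (unique e)
    ; sound    = sound e ∘′ ∈-resp-↭ (↭-sym xs↭ys)
    ; complete = ∈-resp-↭ xs↭ys ∘′ complete e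
    }

  Enumerates-resp-≐ : ∀ {P Q : Pred A 0ℓ} {xs} → P ≐ Q → Enumerates P xs → Enumerates Q xs
  Enumerates-resp-≐ (P⊆Q , Q⊆P) e = record
    { unique = unique e ; sound = P⊆Q ∘′ sound e ; complete = complete e ∘′ Q⊆P }

  Enumerates-++ : ∀ {P Q : Pred A 0ℓ} {xs ys} → (∀ {x} → P x → Q x → ⊥) →
                  Enumerates P xs → Enumerates Q ys → Enumerates (P ∪ Q) (xs ++ ys)
  Enumerates-++ {xs = xs} {ys} P⊥Q e f = record
    { unique   = Unique.++⁺ (unique e) (unique f) (λ (x∈xs , x∈ys) → P⊥Q (sound e x∈xs) (sound f x∈ys))
    ; sound    = [ inj₁ ∘′ sound e , inj₂ ∘′ sound f ]′ ∘′ ∈-++⁻ xs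
    ; complete = [ (λ px → ∈-++⁺ˡ (complete e px)) , (λ qx → ∈-++⁺ʳ xs (complete f qx)) ]′
    }

  Enumerates-insert : ∀ {P Q : Pred A 0ℓ} B {α β C ys} → (∀ {x} → P x → Q x → ⊥) →
                      Enumerates P (B ++ α ∷ β ∷ C) → Enumerates Q ys →
                      Enumerates (P ∪ Q) (B ++ α ∷ ys ++ β ∷ C)
  Enumerates-insert {P} {Q} B {α} {β} {C} {ys} P⊥Q e f =
    Enumerates-resp-↭ {P ∪ Q} reorder (Enumerates-++ P⊥Q e f)
    where
    reorder : (B ++ α ∷ β ∷ C) ++ ys ↭ B ++ α ∷ ys ++ β ∷ C
    reorder rewrite ++-assoc B (α ∷ β ∷ C) ys = ++⁺ˡ B (prep α (++-comm (β ∷ C) ys))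

  Enumerates-reverse : ∀ {P : Pred A 0ℓ} {xs} → Enumerates P xs → Enumerates P (reverse xs)
  Enumerates-reverse {P} {xs} = Enumerates-resp-↭ {P} (↭-sym (↭-reverse xs))

  Enumerates-tabulate : ∀ {P : Pred A 0ℓ} {k} {f : Fin k → A} → Injective _≡_ _≡_ f → (∀ i → P (f i)) →
                        (∀ x → P x → ∃ λ i → f i ≡ x) → Enumerates P (tabulate f)
  Enumerates-tabulate {P} {f = f} f-inj Pf f-onto = record
    { unique   = Unique.tabulate⁺ f-inj
    ; sound    = λ x∈ → let i , x≡fi = ∈-tabulate⁻ x∈ in subst P (sym x≡fi) (Pf i)
    ; complete = λ {x} px → let i , fi≡x = f-onto x px in subst (_∈ tabulate f) fi≡x (∈-tabulate⁺ i)
    }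

  Enumerates-map : ∀ {A′ : Set} {P : Pred A 0ℓ} {Q : Pred A′ 0ℓ} {xs} (f : A → A′) (g : A′ → A) →
                   Injective _≡_ _≡_ f → (∀ y → f (g y) ≡ y) →
                   (∀ x → P x → Q (f x)) → (∀ y → Q y → P (g y)) →
                   Enumerates P xs → Enumerates Q (map f xs)
  Enumerates-map {Q = Q} f g f-inj fg≗id P⇒Qf Q⇒Pg e = record
    { unique   = Unique.map⁺ f-inj (unique e)
    ; sound    = λ y∈ → let x , x∈ , y≡fx = ∈-map⁻ f y∈ in subst Q (sym y≡fx) (P⇒Qf x (sound e x∈))
    ; complete = λ {y} qy → subst (_∈ map f _) (fg≗id y) (∈-map⁺ f (complete e (Q⇒Pg y qy)))
    }

  Enumerates⇒≤length : ∀ {P : Pred A 0ℓ} {xs k} {f : Fin k → A} → Enumerates P xs →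
                       Injective _≡_ _≡_ f → (∀ i → P (f i)) → k ≤ length xs
  Enumerates⇒≤length {xs = xs} {f = f} e f-inj Pf = injective⇒≤ position-injective
    where
    position : ∀ i → Fin (length xs)
    position i = Any.index (complete e (Pf i))
    position-injective : Injective _≡_ _≡_ position
    position-injective {i} {j} eq = f-inj (begin
      f i                     ≡⟨ lookup-index (complete e (Pf i)) ⟩
      lookup xs (position i)  ≡⟨ cong (lookup xs) eq ⟩
      lookup xs (position j)  ≡⟨ lookup-index (complete e (Pf j)) ⟨
      f j                     ∎)
      where open ≡-Reasoning

Unique-middle : ∀ {A : Set} B {p z q : A} {C} → Unique (B ++ p ∷ z ∷ q ∷ C) → p ≢ q
Unique-middle []      ((_ ∷ p≢q ∷ _) ∷ _) = p≢q
Unique-middle (_ ∷ B) (_ ∷ unique)        = Unique-middle B unique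

module _ {A : Set} (R : A → A → Set) where

  infixr 5 _◅_

  data Walk : A → A → List A → Set where
    stop : ∀ x → Walk x x (x ∷ [])
    _◅_  : ∀ {x y z zs} → R x y → Walk y z (y ∷ zs) → Walk x z (x ∷ y ∷ zs)

  walk-join : ∀ {x y z w xs zs} → Walk x y xs → R y z → Walk z w (z ∷ zs) → Walk x w (xs ++ z ∷ zs)
  walk-join (stop x)  r q = r ◅ q
  walk-join (r′ ◅ p) r q = r′ ◅ walk-join p r q

  walk-reverse : (∀ {x y} → R x y → R y x) → ∀ {x y xs} → Walk x y xs → Walk y x (reverse xs)
  walk-reverse R-sym (stop x) = stop x
  walk-reverse R-sym {x} (_◅_ {y = y} {zs = zs} r w) =
    subst (Walk _ x) (sym (unfold-reverse x (y ∷ zs))) (walk-join (walk-reverse R-sym w) (R-sym r) (stop x))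

  walk-head : ∀ {x y z zs} → Walk x y (z ∷ zs) → x ≡ z
  walk-head (stop _) = refl
  walk-head (_ ◅ _)  = refl

  walk-∷ : ∀ {x y xs} → Walk x y xs → ∃ λ ys → xs ≡ x ∷ ys
  walk-∷ (stop x) = [] , refl
  walk-∷ (_◅_ {y = y} {zs = zs} _ _) = y ∷ zs , refl

  walk-splice : ∀ B {x y p q x′ y′ C ys} → Walk x y (B ++ p ∷ q ∷ C) →
                R p x′ → Walk x′ y′ ys → R y′ q → Walk x y (B ++ p ∷ ys ++ q ∷ C)
  walk-splice B w r w′ r′ with walk-∷ w′
  ... | _ , refl = splice B w r w′ r′
    where
    splice : ∀ B {x y p q x′ y′ C ys} → Walk x y (B ++ p ∷ q ∷ C) →
             R p x′ → Walk x′ y′ (x′ ∷ ys) → R y′ q → Walk x y (B ++ p ∷ x′ ∷ ys ++ q ∷ C)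
    -- B = [b] is split off so that the list index of the remaining walk is visibly a cons.
    splice []          (_ ◅ w) r w′ r′ = r ◅ walk-join w′ r′ w
    splice (_ ∷ [])    (r ◅ w) r′ w′ r″ = r ◅ splice [] w r′ w′ r″
    splice (_ ∷ _ ∷ B) (r ◅ w) r′ w′ r″ = r ◅ splice (_ ∷ B) w r′ w′ r″

  Neighbours : A → List A → Set
  Neighbours z xs = ∃₂ λ B C → ∃₂ λ p q → xs ≡ B ++ p ∷ z ∷ q ∷ C × R p z × R z q

  walk-neighbours : ∀ {x y z xs} → Walk x y xs → z ∈ xs → z ≢ x → z ≢ y → Neighbours z xs
  walk-neighbours w (here refl) z≢x _ = ⊥-elim (z≢x (sym (walk-head w)))
  walk-neighbours (r ◅ w) (there z∈) _ z≢y = tail-neighbours (r ◅ w) z∈ z≢y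
    where
    tail-neighbours : ∀ {x y z zs} → Walk x y (x ∷ zs) → z ∈ zs → z ≢ y → Neighbours z (x ∷ zs)
    tail-neighbours (r ◅ stop _)     (here refl) z≢y = ⊥-elim (z≢y refl)
    tail-neighbours {x} (r ◅ r′ ◅ w) (here refl) _   = [] , _ , x , _ , refl , r , r′
    tail-neighbours {x} (r ◅ w)      (there z∈)  z≢y with tail-neighbours w z∈ z≢y
    ... | B , C , p , q , eq , rp , rq = x ∷ B , C , p , q , cong (x ∷_) eq , rp , rq

  walk-tabulate : ∀ k (f : Fin (suc k) → A) → (∀ i → R (f (inject₁ i)) (f (fsuc i))) →
                  Walk (f fzero) (f (fromℕ k)) (tabulate f)
  walk-tabulate zero    f adj = stop (f fzero)
  walk-tabulate (suc k) f adj = adj fzero ◅ walk-tabulate k (f ∘′ fsuc) (λ i → adj (fsuc i))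

  walk-lookup : ∀ {x y z zs} → Walk x y (z ∷ zs) → (i : Fin (length zs)) →
                R (lookup (z ∷ zs) (inject₁ i)) (lookup (z ∷ zs) (fsuc i))
  walk-lookup (r ◅ _) fzero    = r
  walk-lookup (_ ◅ w) (fsuc i) = walk-lookup w i

  walk-last : ∀ {x y z zs} → Walk x y (z ∷ zs) → lookup (z ∷ zs) (fromℕ (length zs)) ≡ y
  walk-last (stop _) = refl
  walk-last (_ ◅ w)  = walk-last w

walk-mono : ∀ {A : Set} {R S : A → A → Set} → (∀ {x y} → R x y → S x y) →
            ∀ {x y xs} → Walk R x y xs → Walk S x y xs
walk-mono F (stop x) = stop x
walk-mono F (r ◅ w)  = F r ◅ walk-mono F w

walk-map : ∀ {A B : Set} {R : A → A → Set} {S : B → B → Set} (f : A → B) →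
           (∀ {x y} → R x y → S (f x) (f y)) →
           ∀ {x y xs} → Walk R x y xs → Walk S (f x) (f y) (map f xs)
walk-map f F (stop x) = stop (f x)
walk-map f F (r ◅ w)  = F r ◅ walk-map f F w

-- ℤ_m as an abelian group

module ℤ/suc (n : ℕ) where

  N : ℕ
  N = suc n

  toℕ-mod : ∀ k → toℕ (k mod N) ≡ k % N
  toℕ-mod k = toℕ-fromℕ< (m%n<n k N)

  [m%N+k]%N≡[m+k]%N : ∀ m k → (m % N + k) % N ≡ (m + k) % N
  [m%N+k]%N≡[m+k]%N m k = begin
    (m % N + k) % N          ≡⟨ %-distribˡ-+ (m % N) k N ⟩
    (m % N % N + k % N) % N  ≡⟨ cong (λ i → (i + k % N) % N) (m%n%n≡m%n m N) ⟩
    (m % N + k % N) % N      ≡⟨ %-distribˡ-+ m k N ⟨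
    (m + k) % N              ∎
    where open ≡-Reasoning

  [m+k%N]%N≡[m+k]%N : ∀ m k → (m + k % N) % N ≡ (m + k) % N
  [m+k%N]%N≡[m+k]%N m k = begin
    (m + k % N) % N  ≡⟨ cong (_% N) (+-comm m (k % N)) ⟩
    (k % N + m) % N  ≡⟨ [m%N+k]%N≡[m+k]%N k m ⟩
    (k + m) % N      ≡⟨ cong (_% N) (+-comm k m) ⟩
    (m + k) % N      ∎
    where open ≡-Reasoning

  toℕ-⊕ : ∀ (x y : Fin N) → toℕ (x ⊕ y) ≡ (toℕ x + toℕ y) % N
  toℕ-⊕ x y = toℕ-mod (toℕ x + toℕ y)

  ⊕-assoc : ∀ (x y z : Fin N) → (x ⊕ y) ⊕ z ≡ x ⊕ (y ⊕ z)
  ⊕-assoc x y z = toℕ-injective (begin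
    toℕ ((x ⊕ y) ⊕ z)                 ≡⟨ toℕ-⊕ (x ⊕ y) z ⟩
    (toℕ (x ⊕ y) + toℕ z) % N         ≡⟨ cong (λ i → (i + toℕ z) % N) (toℕ-⊕ x y) ⟩
    ((toℕ x + toℕ y) % N + toℕ z) % N ≡⟨ [m%N+k]%N≡[m+k]%N (toℕ x + toℕ y) (toℕ z) ⟩
    (toℕ x + toℕ y + toℕ z) % N       ≡⟨ cong (_% N) (+-assoc (toℕ x) _ _) ⟩
    (toℕ x + (toℕ y + toℕ z)) % N     ≡⟨ [m+k%N]%N≡[m+k]%N (toℕ x) (toℕ y + toℕ z) ⟨
    (toℕ x + (toℕ y + toℕ z) % N) % N ≡⟨ cong (λ i → (toℕ x + i) % N) (toℕ-⊕ y z) ⟨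
    (toℕ x + toℕ (y ⊕ z)) % N         ≡⟨ toℕ-⊕ x (y ⊕ z) ⟨
    toℕ (x ⊕ (y ⊕ z))                 ∎)
    where open ≡-Reasoning

  ⊕-comm : ∀ (x y : Fin N) → x ⊕ y ≡ y ⊕ x
  ⊕-comm x y = cong (_mod N) (+-comm (toℕ x) (toℕ y))

  ⊕-identityˡ : ∀ (x : Fin N) → fzero ⊕ x ≡ x
  ⊕-identityˡ x = toℕ-injective (trans (toℕ-⊕ fzero x) (m<n⇒m%n≡m (toℕ<n x)))

  ⊖-inverseʳ : ∀ (x : Fin N) → x ⊕ (⊖ x) ≡ fzero
  ⊖-inverseʳ x = toℕ-injective (begin
    toℕ (x ⊕ (⊖ x))               ≡⟨ toℕ-⊕ x (⊖ x) ⟩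
    (toℕ x + toℕ (⊖ x)) % N       ≡⟨ cong (λ i → (toℕ x + i) % N) (toℕ-mod (N ∸ toℕ x)) ⟩
    (toℕ x + (N ∸ toℕ x) % N) % N ≡⟨ [m+k%N]%N≡[m+k]%N (toℕ x) (N ∸ toℕ x) ⟩
    (toℕ x + (N ∸ toℕ x)) % N     ≡⟨ cong (_% N) (m+[n∸m]≡n (<⇒≤ (toℕ<n x))) ⟩
    N % N                         ≡⟨ n%n≡0 N ⟩
    0                             ∎)
    where open ≡-Reasoning

  ⊕-⊖-isAbelianGroup : IsAbelianGroup _≡_ _⊕_ fzero ⊖_
  ⊕-⊖-isAbelianGroup = record
    { isGroup = record
      { isMonoid = record
        { isSemigroup = record { isMagma = isMagma _⊕_ ; assoc = ⊕-assoc }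
        ; identity    = comm∧idˡ⇒id ⊕-comm ⊕-identityˡ
        }
      ; inverse = comm∧invʳ⇒inv ⊕-comm ⊖-inverseʳ
      ; ⁻¹-cong = cong ⊖_
      }
    ; comm = ⊕-comm
    }

  ⊕-⊖-abelianGroup : AbelianGroup 0ℓ 0ℓ
  ⊕-⊖-abelianGroup = record { isAbelianGroup = ⊕-⊖-isAbelianGroup }

  open AbelianGroup ⊕-⊖-abelianGroup public
    using (identityˡ; identityʳ; commutativeSemigroup; monoid)
  open AbelianGroupProperties ⊕-⊖-abelianGroup public
    using (//-rightDividesˡ; //-rightDividesʳ; ⁻¹-involutive; ⁻¹-∙-comm; inverseʳ-unique)
  open CommutativeSemigroupProperties commutativeSemigroup public
    using (interchange; xy∙z≈xz∙y)
  open MonoidMultiplication monoid public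
    using () renaming (_×_ to _·_; ×-homo-+ to ·-homo-+; ×-assocˡ to ·-assocˡ)

  ⊕-cancelʳ : ∀ t {x y : Fin N} → x ⊕ t ≡ y ⊕ t → x ≡ y
  ⊕-cancelʳ t {x} {y} eq = begin
    x                 ≡⟨ //-rightDividesʳ t x ⟨
    (x ⊕ t) ⊕ (⊖ t)   ≡⟨ cong (_⊕ (⊖ t)) eq ⟩
    (y ⊕ t) ⊕ (⊖ t)   ≡⟨ //-rightDividesʳ t y ⟩
    y                 ∎
    where open ≡-Reasoning

  toℕ-· : ∀ k (x : Fin N) → toℕ (k · x) ≡ k * toℕ x % N
  toℕ-· zero    x = refl
  toℕ-· (suc k) x = begin
    toℕ (x ⊕ (k · x))            ≡⟨ toℕ-⊕ x (k · x) ⟩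
    (toℕ x + toℕ (k · x)) % N    ≡⟨ cong (λ i → (toℕ x + i) % N) (toℕ-· k x) ⟩
    (toℕ x + k * toℕ x % N) % N  ≡⟨ [m+k%N]%N≡[m+k]%N (toℕ x) (k * toℕ x) ⟩
    (toℕ x + k * toℕ x) % N      ∎
    where open ≡-Reasoning

  [k*N]·x≡0 : ∀ k (x : Fin N) → (k * N) · x ≡ fzero
  [k*N]·x≡0 k x = toℕ-injective (begin
    toℕ ((k * N) · x)       ≡⟨ toℕ-· (k * N) x ⟩
    k * N * toℕ x % N       ≡⟨ cong (_% N) (*-assoc k N (toℕ x)) ⟩
    k * (N * toℕ x) % N     ≡⟨ cong (λ i → k * i % N) (*-comm N (toℕ x)) ⟩
    k * (toℕ x * N) % N     ≡⟨ cong (_% N) (*-assoc k (toℕ x) N) ⟨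
    k * toℕ x * N % N       ≡⟨ m*n%n≡0 (k * toℕ x) N ⟩
    0                       ∎)
    where open ≡-Reasoning

  N·x≡0 : ∀ (x : Fin N) → N · x ≡ fzero
  N·x≡0 x = trans (cong (_· x) (sym (*-identityˡ N))) ([k*N]·x≡0 1 x)

  ·-% : ∀ k (x : Fin N) → k · x ≡ (k % N) · x
  ·-% k x = begin
    k · x                                   ≡⟨ cong (_· x) (m≡m%n+[m/n]*n k N) ⟩
    (k % N + k / N * N) · x                 ≡⟨ ·-homo-+ x (k % N) (k / N * N) ⟩
    ((k % N) · x) ⊕ ((k / N * N) · x)       ≡⟨ cong (((k % N) · x) ⊕_) ([k*N]·x≡0 (k / N) x) ⟩
    ((k % N) · x) ⊕ fzero                   ≡⟨ identityʳ _ ⟩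
    (k % N) · x                             ∎
    where open ≡-Reasoning

  ⊖-· : ∀ k (x : Fin N) → ⊖ (k · x) ≡ (k * n) · x
  ⊖-· k x = sym (inverseʳ-unique (k · x) ((k * n) · x) (begin
    (k · x) ⊕ ((k * n) · x)   ≡⟨ ·-homo-+ x k (k * n) ⟨
    (k + k * n) · x           ≡⟨ cong (_· x) (*-suc k n) ⟨
    (k * N) · x               ≡⟨ [k*N]·x≡0 k x ⟩
    fzero                     ∎))
    where open ≡-Reasoning

  n·x≡⊖x : ∀ (x : Fin N) → n · x ≡ ⊖ x
  n·x≡⊖x x = inverseʳ-unique x (n · x) (N·x≡0 x)

-- Hamilton cycles and paths as walks

csuc-inject₁ : ∀ {k} (i : Fin k) → csuc (inject₁ i) ≡ fsuc i
csuc-inject₁ {k} i = toℕ-injective (begin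
  toℕ (csuc (inject₁ i))         ≡⟨ ℤ/suc.toℕ-mod k (suc (toℕ (inject₁ i))) ⟩
  suc (toℕ (inject₁ i)) % suc k  ≡⟨ cong (λ t → suc t % suc k) (toℕ-inject₁ i) ⟩
  suc (toℕ i) % suc k            ≡⟨ m<n⇒m%n≡m (s≤s (toℕ<n i)) ⟩
  suc (toℕ i)                    ∎)
  where open ≡-Reasoning

csuc-fromℕ : ∀ k → csuc (fromℕ k) ≡ fzero
csuc-fromℕ k = toℕ-injective (begin
  toℕ (csuc (fromℕ k))         ≡⟨ ℤ/suc.toℕ-mod k (suc (toℕ (fromℕ k))) ⟩
  suc (toℕ (fromℕ k)) % suc k  ≡⟨ cong (λ t → suc t % suc k) (toℕ-fromℕ k) ⟩
  suc k % suc k                ≡⟨ n%n≡0 (suc k) ⟩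
  0                            ∎)
  where open ≡-Reasoning

csuc≡⊕1 : ∀ {k} (i : Fin (suc (suc k))) → csuc i ≡ i ⊕ fsuc fzero
csuc≡⊕1 {k} i = cong (_mod suc (suc k)) (+-comm 1 (toℕ i))

inject₁⊎fromℕ : ∀ {k} (i : Fin (suc k)) → (∃ λ j → i ≡ inject₁ j) ⊎ i ≡ fromℕ k
inject₁⊎fromℕ {zero}  fzero    = inj₂ refl
inject₁⊎fromℕ {suc k} fzero    = inj₁ (fzero , refl)
inject₁⊎fromℕ {suc k} (fsuc i) with inject₁⊎fromℕ i
... | inj₁ (j , i≡j) = inj₁ (fsuc j , cong fsuc i≡j)
... | inj₂ i≡k       = inj₂ (cong fsuc i≡k)

Unique⇒lookup-injective : ∀ {A : Set} {xs : List A} → Unique xs → Injective _≡_ _≡_ (lookup xs)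
Unique⇒lookup-injective {xs = _ ∷ _}  _            {fzero}  {fzero}  _  = refl
Unique⇒lookup-injective {xs = _ ∷ xs} (x∉xs ∷ _)   {fzero}  {fsuc j} eq =
  ⊥-elim (All¬⇒¬Any x∉xs (subst (_∈ xs) (sym eq) (∈-lookup j)))
Unique⇒lookup-injective {xs = _ ∷ xs} (x∉xs ∷ _)   {fsuc i} {fzero}  eq =
  ⊥-elim (All¬⇒¬Any x∉xs (subst (_∈ xs) eq (∈-lookup i)))
Unique⇒lookup-injective {xs = _ ∷ _}  (_ ∷ unique) {fsuc i} {fsuc j} eq =
  cong fsuc (Unique⇒lookup-injective unique eq)

module _ {m} {P : V m → Set} {R : V m → V m → Set} where

  HamPath⇒walk : ∀ {s t} → HamPath P R s t → ∃ λ xs → Walk R s t xs × Enumerates P xs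
  HamPath⇒walk p = tabulate w , subst₂ (λ x y → Walk R x y (tabulate w)) start end (walk-tabulate R k w adj)
                 , Enumerates-tabulate inj inP cover
    where open HamPath p

  closedWalk⇒HamCycle : ∀ {x y z zs} → Walk R x y (z ∷ zs) → R y x → Enumerates P (z ∷ zs) →
                        3 ≤ length (z ∷ zs) → HamCycle P R
  closedWalk⇒HamCycle {x} {y} {z} {zs} walk closing e 3≤len = record
    { len    = length (z ∷ zs)
    ; len≥3  = 3≤len
    ; w      = w
    ; inj    = Unique⇒lookup-injective (unique e)
    ; inP    = λ i → sound e (∈-lookup i)
    ; cover  = λ v pv → Any.index (complete e pv) , sym (lookup-index (complete e pv))
    ; adj    = adj
    }
    where
    w : Fin (length (z ∷ zs)) → V m
    w = lookup (z ∷ zs)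
    adj : ∀ i → R (w i) (w (csuc i))
    adj i with inject₁⊎fromℕ i
    ... | inj₁ (j , refl) =
      subst (R (w (inject₁ j)) ∘′ w) (sym (csuc-inject₁ j)) (walk-lookup R walk j)
    ... | inj₂ refl       =
      subst (R (w (fromℕ (length zs))) ∘′ w) (sym (csuc-fromℕ (length zs)))
            (subst₂ R (sym (walk-last R walk)) (walk-head R walk) closing)

  private
    rotate : ∀ {len} → 3 ≤ len → (w : Fin len → V m) → Injective _≡_ _≡_ w → (∀ i → P (w i)) →
             (∀ x → P x → ∃ λ i → w i ≡ x) → (∀ i → R (w i) (w (csuc i))) → ∀ {z} → (∃ λ i → w i ≡ z) →
             ∃₂ λ x y → ∃ λ xs → Walk R x y xs × R y x × Enumerates P xs × z ≢ x × z ≢ y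
    -- Start the cycle at position i₀ − 1, so that z becomes its second vertex.
    rotate {suc (suc (suc k))} (s≤s (s≤s (s≤s _))) w inj inP cover adj (i₀ , wi₀≡z) =
      _ , _ , _ , walk , closing , enum , z≢first , z≢last
      where
      open ℤ/suc (suc (suc k))
      one : Fin N
      one = fsuc fzero
      s : Fin N
      s = i₀ ⊕ (⊖ one)
      one⊕s≡i₀ : one ⊕ s ≡ i₀
      one⊕s≡i₀ = trans (⊕-comm one s) (//-rightDividesˡ one i₀)
      w′ : Fin N → V m
      w′ j = w (j ⊕ s)
      w′-inj : Injective _≡_ _≡_ w′
      w′-inj eq = ⊕-cancelʳ s (inj eq)
      w′-adj : ∀ j → R (w′ j) (w′ (csuc j))
      w′-adj j = subst (λ t → R (w′ j) (w t)) csuc-⊕s (adj (j ⊕ s))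
        where
        csuc-⊕s : csuc (j ⊕ s) ≡ csuc j ⊕ s
        csuc-⊕s = trans (csuc≡⊕1 (j ⊕ s)) (trans (xy∙z≈xz∙y j s one) (cong (_⊕ s) (sym (csuc≡⊕1 j))))
      walk : Walk R (w′ fzero) (w′ (fromℕ (suc (suc k)))) (tabulate w′)
      walk = walk-tabulate R (suc (suc k)) w′
               (λ i → subst (R (w′ (inject₁ i)) ∘′ w′) (csuc-inject₁ i) (w′-adj (inject₁ i)))
      closing : R (w′ (fromℕ (suc (suc k)))) (w′ fzero)
      closing = subst (R (w′ (fromℕ (suc (suc k)))) ∘′ w′) (csuc-fromℕ (suc (suc k))) (w′-adj (fromℕ _))
      enum : Enumerates P (tabulate w′)
      enum = Enumerates-tabulate w′-inj (λ j → inP (j ⊕ s))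
               (λ x px → let i , wi≡x = cover x px in i ⊕ (⊖ s) , trans (cong w (//-rightDividesˡ s i)) wi≡x)
      w′one≡z : w′ one ≡ _
      w′one≡z = trans (cong w one⊕s≡i₀) wi₀≡z
      z≢first : _ ≢ w′ fzero
      z≢first z≡first with w′-inj {one} {fzero} (trans w′one≡z z≡first)
      ... | ()
      z≢last : _ ≢ w′ (fromℕ (suc (suc k)))
      z≢last z≡last with w′-inj {one} {fromℕ (suc (suc k))} (trans w′one≡z z≡last)
      ... | ()

  HamCycle⇒closedWalk : HamCycle P R → ∀ {z} → P z →
      ∃₂ λ x y → ∃ λ xs → Walk R x y xs × R y x × Enumerates P xs × z ≢ x × z ≢ y
  HamCycle⇒closedWalk C pz = rotate len≥3 w inj inP cover adj (cover _ pz)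
    where open HamCycle C

-- The subgroup Λ and the translates of H₀

module Subgroup {n : ℕ} (a b : Fin (suc n)) where

  open ℤ/suc n

  Λ-· : ∀ k {x} → Λ a b x → Λ a b (k · x)
  Λ-· zero    _ = gen-0
  Λ-· (suc k) p = gen-add p (Λ-· k p)

  infix 4 _∼_

  data _∼_ (x y : Fin N) : Set where
    mod-Λ : ∀ {t} → Λ a b t → x ≡ y ⊕ t → x ∼ y

  ∼-refl : ∀ {x} → x ∼ x
  ∼-refl {x} = mod-Λ gen-0 (sym (identityʳ x))

  ∼-sym : ∀ {x y} → x ∼ y → y ∼ x
  ∼-sym {x} {y} (mod-Λ {t} t∈Λ x≡y⊕t) =
    mod-Λ (gen-neg t∈Λ) (trans (sym (//-rightDividesʳ t y)) (cong (_⊕ (⊖ t)) (sym x≡y⊕t)))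

  ∼-trans : ∀ {x y z} → x ∼ y → y ∼ z → x ∼ z
  ∼-trans {x} {y} {z} (mod-Λ {t} t∈Λ x≡y⊕t) (mod-Λ {t′} t′∈Λ y≡z⊕t′) =
    mod-Λ (gen-add t′∈Λ t∈Λ) (trans x≡y⊕t (trans (cong (_⊕ t) y≡z⊕t′) (⊕-assoc z t′ t)))

  ∼-⊕ : ∀ {x y} s → x ∼ y → x ⊕ s ∼ y ⊕ s
  ∼-⊕ {x} {y} s (mod-Λ {t} t∈Λ x≡y⊕t) = mod-Λ t∈Λ (trans (cong (_⊕ s) x≡y⊕t) (xy∙z≈xz∙y y t s))

  ∼⇒Λ⊖ : ∀ {x y} → x ∼ y → Λ a b (x ⊕ (⊖ y))
  ∼⇒Λ⊖ {x} {y} (mod-Λ {t} t∈Λ x≡y⊕t) = subst (Λ a b) t≡x⊖y t∈Λ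
    where
    t≡x⊖y : t ≡ x ⊕ (⊖ y)
    t≡x⊖y = trans (sym (//-rightDividesʳ y t)) (cong (_⊕ (⊖ y)) (trans (⊕-comm t y) (sym x≡y⊕t)))

  ⊕Λ∼ : ∀ {x t} → Λ a b t → x ⊕ t ∼ x
  ⊕Λ∼ t∈Λ = mod-Λ t∈Λ refl

  ∼-cancelʳ : ∀ {y s} → y ⊕ s ∼ y → Λ a b s
  ∼-cancelʳ {y} {s} (mod-Λ {t} t∈Λ y⊕s≡y⊕t) = subst (Λ a b) (sym s≡t) t∈Λ
    where
    s≡t : s ≡ t
    s≡t = ⊕-cancelʳ y (trans (⊕-comm s y) (trans y⊕s≡y⊕t (⊕-comm y t)))

  Λ⇒∼0 : ∀ {x} → Λ a b x → x ∼ fzero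
  Λ⇒∼0 {x} x∈Λ = mod-Λ x∈Λ (sym (identityˡ x))

  ∼0⇒Λ : ∀ {x} → x ∼ fzero → Λ a b x
  ∼0⇒Λ (mod-Λ t∈Λ x≡0⊕t) = subst (Λ a b) (sym (trans x≡0⊕t (identityˡ _))) t∈Λ

  private
    Combination : Fin N → Set
    Combination x = ∃₂ λ i j → x ≡ (i · a) ⊕ (j · b)

    Λ⇒combination : ∀ {x} → Λ a b x → Combination x
    Λ⇒combination gen-a = 1 , 0 , sym (trans (identityʳ _) (identityʳ a))
    Λ⇒combination gen-b = 0 , 1 , sym (trans (identityˡ _) (identityʳ b))
    Λ⇒combination gen-0 = 0 , 0 , sym (identityʳ fzero)
    Λ⇒combination (gen-add p q) with Λ⇒combination p | Λ⇒combination q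
    ... | i , j , refl | i′ , j′ , refl = i + i′ , j + j′ , (begin
      ((i · a) ⊕ (j · b)) ⊕ ((i′ · a) ⊕ (j′ · b))  ≡⟨ interchange (i · a) (j · b) (i′ · a) (j′ · b) ⟩
      ((i · a) ⊕ (i′ · a)) ⊕ ((j · b) ⊕ (j′ · b))  ≡⟨ cong₂ _⊕_ (·-homo-+ a i i′) (·-homo-+ b j j′) ⟨
      ((i + i′) · a) ⊕ ((j + j′) · b)              ∎)
      where open ≡-Reasoning
    Λ⇒combination (gen-neg p) with Λ⇒combination p
    ... | i , j , refl = i * n , j * n , (begin
      ⊖ ((i · a) ⊕ (j · b))              ≡⟨ ⁻¹-∙-comm (i · a) (j · b) ⟨
      (⊖ (i · a)) ⊕ (⊖ (j · b))          ≡⟨ cong₂ _⊕_ (⊖-· i a) (⊖-· j b) ⟩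
      ((i * n) · a) ⊕ ((j * n) · b)      ∎)
      where open ≡-Reasoning

    reduce : ∀ k x → k · x ≡ toℕ (k mod N) · x
    reduce k x = trans (·-% k x) (cong (_· x) (sym (toℕ-mod k)))

  -- Λ consists of the combinations i a + j b with i, j < m, a finite search.
  Λ? : Decidable (Λ a b)
  Λ? x = map′ from to (any? λ i → any? λ j → x ≟ (toℕ i · a) ⊕ (toℕ j · b))
    where
    from : ∃₂ (λ i j → x ≡ (toℕ i · a) ⊕ (toℕ j · b)) → Λ a b x
    from (i , j , eq) = subst (Λ a b) (sym eq) (gen-add (Λ-· (toℕ i) gen-a) (Λ-· (toℕ j) gen-b))
    to : Λ a b x → ∃₂ (λ i j → x ≡ (toℕ i · a) ⊕ (toℕ j · b))
    to x∈Λ with Λ⇒combination x∈Λ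
    ... | i , j , eq = i mod N , j mod N , trans eq (cong₂ _⊕_ (reduce i a) (reduce j b))

module CopiesOfH0 {n : ℕ} (a b c : Fin (suc n)) where

  open ℤ/suc n
  open Subgroup a b

  private
    least-period : ∃ λ ℓ → Λ a b (suc ℓ · c) × (∀ k → k < ℓ → ¬ Λ a b (suc k · c))
    least-period with ¬∀⟶∃¬-smallest N (λ i → ¬ Λ a b (suc (toℕ i) · c)) (λ i → ¬? (Λ? _)) N·c∈Λ
      where
      N·c∈Λ : ¬ (∀ i → ¬ Λ a b (suc (toℕ i) · c))
      N·c∈Λ ∀¬ = ∀¬ (fromℕ n) (subst (λ k → Λ a b (suc k · c)) (sym (toℕ-fromℕ n))
                                       (subst (Λ a b) (sym (N·x≡0 c)) gen-0))
    ... | i , ¬¬Λ , earlier = toℕ i , decidable-stable (Λ? _) ¬¬Λ , minimal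
      where
      minimal : ∀ k → k < toℕ i → ¬ Λ a b (suc k · c)
      minimal k k<i = subst (λ k → ¬ Λ a b (suc k · c)) (trans (toℕ-inject j) (toℕ-fromℕ< k<i)) (earlier j)
        where j = fromℕ< k<i

  ℓ : ℕ
  ℓ = proj₁ least-period

  period∈Λ : Λ a b (suc ℓ · c)
  period∈Λ = proj₁ (proj₂ least-period)

  period-minimal : ∀ k → k < ℓ → ¬ Λ a b (suc k · c)
  period-minimal = proj₂ (proj₂ least-period)

  -- Copy j x: the vertices u_x, v_x belong to the translate H₀ + j c.
  record Copy (j : ℕ) (x : Fin N) : Set where
    constructor copy
    field offset : x ∼ j · c

  Copies : ℕ → ℕ → Fin N → Set
  Copies j zero    x = Copy j x
  Copies j (suc r) x = Copy j x ⊎ Copies (suc j) r x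

  Copy-disjoint : ∀ {j k x} → j < k → k ≤ ℓ → Copy j x → Copy k x → ⊥
  Copy-disjoint {j} {x = x} j<k k≤ℓ (copy x∈j) (copy x∈k) with m≤n⇒∃[o]m+o≡n j<k
  ... | d , refl = period-minimal d d<ℓ (∼-cancelʳ j·c⊕[1+d]·c∼j·c)
    where
    d<ℓ : d < ℓ
    d<ℓ = m+n≤o⇒n≤o j (subst (_≤ ℓ) (sym (+-suc j d)) k≤ℓ)
    j·c⊕[1+d]·c∼j·c : (j · c) ⊕ (suc d · c) ∼ j · c
    j·c⊕[1+d]·c∼j·c =
      ∼-trans (∼-sym (subst (x ∼_) (trans (cong (_· c) (sym (+-suc j d))) (·-homo-+ c j (suc d))) x∈k)) x∈j

  Copy-Copies-disjoint : ∀ {j k} r {x} → j < k → k + r ≤ ℓ → Copy j x → Copies k r x → ⊥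
  Copy-Copies-disjoint zero    j<k k+0≤ℓ x∈j x∈k = Copy-disjoint j<k (m+n≤o⇒m≤o _ k+0≤ℓ) x∈j x∈k
  Copy-Copies-disjoint (suc r) j<k k+r≤ℓ x∈j (inj₁ x∈k) = Copy-disjoint j<k (m+n≤o⇒m≤o _ k+r≤ℓ) x∈j x∈k
  Copy-Copies-disjoint {k = k} (suc r) j<k k+r≤ℓ x∈j (inj₂ x∈k+) =
    Copy-Copies-disjoint r (m<n⇒m<1+n j<k) (subst (_≤ ℓ) (+-suc k r) k+r≤ℓ) x∈j x∈k+

  Copies-complete : ∀ {j} k r {x} → k ≤ r → Copy (j + k) x → Copies j r x
  Copies-complete {j} zero    zero    {x} _ x∈j = subst (λ i → Copy i x) (+-identityʳ j) x∈j
  Copies-complete {j} zero    (suc r) {x} _ x∈j = inj₁ (subst (λ i → Copy i x) (+-identityʳ j) x∈j)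
  Copies-complete {j} (suc k) (suc r) {x} (s≤s k≤r) x∈j+k =
    inj₂ (Copies-complete k r k≤r (subst (λ i → Copy i x) (+-suc j k) x∈j+k))

  Copy-⊕Λ : ∀ {j x t} → Λ a b t → Copy j x → Copy j (x ⊕ t)
  Copy-⊕Λ t∈Λ (copy x∈j) = copy (∼-trans (⊕Λ∼ t∈Λ) x∈j)

  Copy-⊕c : ∀ {j x} → Copy j x → Copy (suc j) (x ⊕ c)
  Copy-⊕c {j} (copy x∈j) = copy (subst (_ ∼_) (⊕-comm (j · c) c) (∼-⊕ c x∈j))

  Copy-⊖c : ∀ {j x} → Copy j x → Copy (j + n) (x ⊕ (⊖ c))
  Copy-⊖c {j} (copy x∈j) =
    copy (subst (_ ∼_) (trans (cong ((j · c) ⊕_) (sym (n·x≡⊖x c))) (sym (·-homo-+ c j n)))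
                (∼-⊕ (⊖ c) x∈j))

  Copy-% : ∀ {k x} → Copy k x → Copy (k % suc ℓ) x
  Copy-% {k} (copy x∈k) = copy (∼-trans x∈k (subst (_∼ ((k % suc ℓ) · c)) k·c-split (⊕Λ∼ multiple∈Λ)))
    where
    multiple∈Λ : Λ a b ((k / suc ℓ * suc ℓ) · c)
    multiple∈Λ = subst (Λ a b) (·-assocˡ c (k / suc ℓ) (suc ℓ)) (Λ-· (k / suc ℓ) period∈Λ)
    k·c-split : ((k % suc ℓ) · c) ⊕ ((k / suc ℓ * suc ℓ) · c) ≡ k · c
    k·c-split = trans (sym (·-homo-+ c (k % suc ℓ) _)) (cong (_· c) (sym (m≡m%n+[m/n]*n k (suc ℓ))))

module RoseWindow {n : ℕ} (a b c : Fin (suc n)) where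

  open ℤ/suc n
  open Subgroup a b
  open CopiesOfH0 a b c

  H0⇒G : ∀ {p q} → H0Adj a b p q → GAdj a b c p q
  H0⇒G = map⊎ edge edge
    where
    edge : ∀ {p q} → H0Edge a b p q → GEdge a b c p q
    edge (outer {x} _) = outer x
    edge (inner {x} _) = inner x
    edge (spoke {x} _) = spoke0 x

  shift-index : ∀ (t : Fin N) (p : V N) → index (shift t p) ≡ index p ⊕ t
  shift-index t (u x) = refl
  shift-index t (v x) = refl

  shift-⊖ : ∀ (t : Fin N) (p : V N) → shift t (shift (⊖ t) p) ≡ p
  shift-⊖ t (u x) = cong u (//-rightDividesˡ t x)
  shift-⊖ t (v x) = cong v (//-rightDividesˡ t x)

  shift-injective : ∀ (t : Fin N) → Injective _≡_ _≡_ (shift t)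
  shift-injective t {u x} {u y} eq = cong u (⊕-cancelʳ t (u-injective eq))
    where
    u-injective : ∀ {i j : Fin N} → u i ≡ u j → i ≡ j
    u-injective refl = refl
  shift-injective t {v x} {v y} eq = cong v (⊕-cancelʳ t (v-injective eq))
    where
    v-injective : ∀ {i j : Fin N} → v i ≡ v j → i ≡ j
    v-injective refl = refl

  shift-H0⇒G : ∀ (t : Fin N) {p q} → H0Adj a b p q → GAdj a b c (shift t p) (shift t q)
  shift-H0⇒G t = map⊎ edge edge
    where
    edge : ∀ {p q} → H0Edge a b p q → GEdge a b c (shift t p) (shift t q)
    edge (outer {x} _) = subst (GEdge a b c (u (x ⊕ t)) ∘′ u) (sym (xy∙z≈xz∙y x a t)) (outer (x ⊕ t))
    edge (inner {x} _) = subst (GEdge a b c (v (x ⊕ t)) ∘′ v) (sym (xy∙z≈xz∙y x b t)) (inner (x ⊕ t))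
    edge (spoke {x} _) = spoke0 (x ⊕ t)

  private
    InSomeCopy : Fin N → Set
    InSomeCopy x = ∃ λ k → Copy k x

    GEdge-copy : ∀ {p q} → GEdge a b c p q → InSomeCopy (index p) → InSomeCopy (index q)
    GEdge-copy (outer _)  (k , x∈k) = k , Copy-⊕Λ gen-a x∈k
    GEdge-copy (inner _)  (k , x∈k) = k , Copy-⊕Λ gen-b x∈k
    GEdge-copy (spoke0 _) (k , x∈k) = k , x∈k
    GEdge-copy (spokec _) (k , x∈k) = suc k , Copy-⊕c x∈k

    GEdge-copy⁻ : ∀ {p q} → GEdge a b c p q → InSomeCopy (index q) → InSomeCopy (index p)
    GEdge-copy⁻ (outer x)  (k , x∈k) = k , subst (Copy k) (//-rightDividesʳ a x) (Copy-⊕Λ (gen-neg gen-a) x∈k)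
    GEdge-copy⁻ (inner x)  (k , x∈k) = k , subst (Copy k) (//-rightDividesʳ b x) (Copy-⊕Λ (gen-neg gen-b) x∈k)
    GEdge-copy⁻ (spoke0 _) (k , x∈k) = k , x∈k
    GEdge-copy⁻ (spokec x) (k , x∈k) = k + n , subst (Copy (k + n)) (//-rightDividesʳ c x) (Copy-⊖c x∈k)

    reachable-copy : ∀ {p q} → Star (GAdj a b c) p q → InSomeCopy (index p) → InSomeCopy (index q)
    reachable-copy = fold (λ p q → InSomeCopy (index p) → InSomeCopy (index q))
                          (λ { (inj₁ e) f → f ∘′ GEdge-copy e ; (inj₂ e) f → f ∘′ GEdge-copy⁻ e }) id

  Connected⇒Copies : Connected (GAdj a b c) → ∀ x → Copies 0 ℓ x
  Connected⇒Copies conn x with reachable-copy (conn (u fzero) (u x)) (0 , copy ∼-refl)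
  ... | k , x∈k = Copies-complete (k % suc ℓ) ℓ (≤-pred (m%n<n k (suc ℓ))) (Copy-% x∈k)

-- Splicing translates of the Hamilton path

module Splicing {n : ℕ} (a b c : Fin (suc n)) where

  open ℤ/suc n
  open Subgroup a b
  open CopiesOfH0 a b c
  open RoseWindow a b c

  data OuterEdge : V N → V N → Set where
    forward  : ∀ x → OuterEdge (u x) (u (x ⊕ a))
    backward : ∀ x → OuterEdge (u (x ⊕ a)) (u x)

  OuterEdge-sym : ∀ {p q} → OuterEdge p q → OuterEdge q p
  OuterEdge-sym (forward x)  = backward x
  OuterEdge-sym (backward x) = forward x

  OuterEdge-shift : ∀ (t : Fin N) {p q} → OuterEdge p q → OuterEdge (shift t p) (shift t q)
  OuterEdge-shift t (forward x)  = subst (OuterEdge (u (x ⊕ t)) ∘′ u) (sym (xy∙z≈xz∙y x a t)) (forward (x ⊕ t))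
  OuterEdge-shift t (backward x) = subst (λ y → OuterEdge (u y) (u (x ⊕ t))) (sym (xy∙z≈xz∙y x a t)) (backward (x ⊕ t))

  OuterEdgeIn : List (V N) → Set
  OuterEdgeIn xs = ∃₂ λ B C → ∃₂ λ p q → xs ≡ B ++ p ∷ q ∷ C × OuterEdge p q

  OuterEdgeIn-shift : ∀ (t : Fin N) {xs} → OuterEdgeIn xs → OuterEdgeIn (map (shift t) xs)
  OuterEdgeIn-shift t (B , C , p , q , refl , e) =
    map (shift t) B , map (shift t) C , shift t p , shift t q , map-++ (shift t) B (p ∷ q ∷ C) , OuterEdge-shift t e

  H0-neighbour-of-u : ∀ {x q} → H0Adj a b (u x) q → OuterEdge (u x) q ⊎ q ≡ v x
  H0-neighbour-of-u (inj₁ (outer _)) = inj₁ (forward _)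
  H0-neighbour-of-u (inj₁ (spoke _)) = inj₂ refl
  H0-neighbour-of-u (inj₂ (outer _)) = inj₁ (backward _)

  outer-edge-beside-u : ∀ {x xs} → Unique xs → Neighbours (H0Adj a b) (u x) xs → OuterEdgeIn xs
  outer-edge-beside-u {x} unique (B , C , p , q , refl , p~u , u~q)
    with H0-neighbour-of-u (swap p~u) | H0-neighbour-of-u u~q
  ... | inj₁ e   | _        = B , q ∷ C , p , u x , refl , OuterEdge-sym e
  ... | inj₂ _   | inj₁ e   = B ++ [ p ] , C , u x , q , sym (++-assoc B [ p ] (u x ∷ q ∷ C)) , e
  ... | inj₂ p≡v | inj₂ q≡v = ⊥-elim (Unique-middle B unique (trans p≡v (sym q≡v)))

  spokec-after-a : ∀ x → GAdj a b c (u (x ⊕ a)) (v ((x ⊕ c) ⊕ a))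
  spokec-after-a x = inj₁ (subst (GEdge a b c (u (x ⊕ a)) ∘′ v) (xy∙z≈xz∙y x a c) (spokec (x ⊕ a)))

  Block : ℕ → ℕ → Fin N → Set
  Block j r y = ∃ λ ys → Walk (GAdj a b c) (v y) (v (y ⊕ a)) ys × Enumerates (Copies j r ∘′ index) ys

  Detour : ℕ → ℕ → V N → V N → Set
  Detour j r p q = ∃₂ λ x y → ∃ λ ys →
    GAdj a b c p x × Walk (GAdj a b c) x y ys × GAdj a b c y q × Enumerates (Copies j r ∘′ index) ys

  detour : ∀ {j r p q} → OuterEdge p q → Copy j (index p) → Copy j (index q) →
           (∀ y → Copy (suc j) y → Block (suc j) r y) → Detour (suc j) r p q
  detour (forward x) x∈j _ block with block (x ⊕ c) (Copy-⊕c x∈j)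
  ... | ys , walk , enum = _ , _ , ys , inj₁ (spokec x) , walk , swap (spokec-after-a x) , enum
  detour (backward x) _ x∈j block with block (x ⊕ c) (Copy-⊕c x∈j)
  ... | ys , walk , enum = _ , _ , _ , spokec-after-a x , walk-reverse _ swap walk , inj₂ (spokec x) , Enumerates-reverse enum

  module _ {path} (path-walk : Walk (H0Adj a b) (v fzero) (v a) path)
                  (path-enum : Enumerates (InH0 a b) path) where

    path-outer : OuterEdgeIn path
    path-outer = outer-edge-beside-u (unique path-enum)
                   (walk-neighbours _ path-walk (complete path-enum gen-0) (λ ()) (λ ()))

    shifted-path : ∀ y → Walk (GAdj a b c) (v y) (v (y ⊕ a)) (map (shift y) path)
    shifted-path y = subst₂ (λ s t → Walk (GAdj a b c) s t (map (shift y) path))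
                            (cong v (identityˡ y)) (cong v (⊕-comm a y))
                            (walk-map (shift y) (shift-H0⇒G y) path-walk)

    shifted-path-enum : ∀ {j y} → Copy j y → Enumerates (Copy j ∘′ index) (map (shift y) path)
    shifted-path-enum {j} {y} (copy y∈j) =
      Enumerates-map (shift y) (shift (⊖ y)) (shift-injective y) (shift-⊖ y) to from path-enum
      where
      to : ∀ p → InH0 a b p → Copy j (index (shift y p))
      to p p∈Λ = subst (Copy j) (trans (⊕-comm y (index p)) (sym (shift-index y p))) (Copy-⊕Λ p∈Λ (copy y∈j))
      from : ∀ p → Copy j (index p) → InH0 a b (shift (⊖ y) p)
      from p (copy p∈j) = subst (Λ a b) (sym (shift-index (⊖ y) p)) (∼⇒Λ⊖ (∼-trans p∈j (∼-sym y∈j)))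

    extend : ∀ r {j x y xs} → j + r ≤ ℓ → Walk (GAdj a b c) x y xs → Enumerates (Copy j ∘′ index) xs →
             OuterEdgeIn xs → ∃ λ ys → Walk (GAdj a b c) x y ys × Enumerates (Copies j r ∘′ index) ys
    extend zero    _ walk enum _ = _ , walk , enum
    extend (suc r) {j} j+r≤ℓ walk enum (B , C , p , q , refl , e) =
      let _ , _ , _ , p~x , walk′ , y~q , enum′ = detour e (sound enum p∈) (sound enum q∈) block
      in  _ , walk-splice _ B walk p~x walk′ y~q ,
          Enumerates-insert B (Copy-Copies-disjoint r (n<1+n j) 1+j+r≤ℓ) enum enum′
      where
      p∈ : p ∈ B ++ p ∷ q ∷ C
      p∈ = ∈-++⁺ʳ B (here refl)
      q∈ : q ∈ B ++ p ∷ q ∷ C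
      q∈ = ∈-++⁺ʳ B (there (here refl))
      1+j+r≤ℓ : suc j + r ≤ ℓ
      1+j+r≤ℓ = subst (_≤ ℓ) (+-suc j r) j+r≤ℓ
      block : ∀ y → Copy (suc j) y → Block (suc j) r y
      block y y∈ = extend r 1+j+r≤ℓ (shifted-path y) (shifted-path-enum y∈) (OuterEdgeIn-shift y path-outer)

    hamiltonian : Connected (GAdj a b c) → HamCycle (InH0 a b) (H0Adj a b) → Hamiltonian (GAdj a b c)
    hamiltonian conn C with HamCycle⇒closedWalk C {u fzero} gen-0
    ... | x , y , xs , walk , closing , enum , u0≢x , u0≢y with extend ℓ ≤-refl (walk-mono H0⇒G walk) copy₀ outer-edge
      where
      copy₀ : Enumerates (Copy 0 ∘′ index) xs
      copy₀ = Enumerates-resp-≐ (copy ∘′ Λ⇒∼0 , ∼0⇒Λ ∘′ Copy.offset) enum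
      outer-edge : OuterEdgeIn xs
      outer-edge = outer-edge-beside-u (unique enum) (walk-neighbours _ walk (complete enum gen-0) u0≢x u0≢y)
    ... | ys , walk′ , copies with walk-∷ _ walk′
    ... | zs , refl = closedWalk⇒HamCycle walk′ (H0⇒G closing) everything
                        (≤-trans (HamCycle.len≥3 C) (Enumerates⇒≤length everything (HamCycle.inj C) _))
      where
      everything : Enumerates (λ _ → ⊤) (x ∷ zs)
      everything = Enumerates-resp-≐ (_ , λ {p} _ → Connected⇒Copies conn (index p)) copies

-- The symmetry u_i ↔ v_i

module _ {m : ℕ} (σ : V m → V m) (σ-involutive : ∀ p → σ (σ p) ≡ p)
         {R S : V m → V m → Set} (R⇒S : ∀ {p q} → R p q → S (σ p) (σ q)) where

  Connected-map : Connected R → Connected S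
  Connected-map conn p q = subst₂ (Star S) (σ-involutive p) (σ-involutive q) (gmap σ R⇒S (conn (σ p) (σ q)))

  module _ {P Q : V m → Set} (P⇒Q : ∀ p → P p → Q (σ p)) (Q⇒P : ∀ p → Q p → P (σ p)) where

    private
      σ-injective : ∀ {p q} → σ p ≡ σ q → p ≡ q
      σ-injective {p} {q} eq = trans (sym (σ-involutive p)) (trans (cong σ eq) (σ-involutive q))

      σ-onto : ∀ {k} (w : Fin k → V m) → (∀ p → P p → ∃ λ i → w i ≡ p) → ∀ q → Q q → ∃ λ i → σ (w i) ≡ q
      σ-onto w cover q qq = let i , wi≡σq = cover (σ q) (Q⇒P q qq) in i , trans (cong σ wi≡σq) (σ-involutive q)

    HamCycle-map : HamCycle P R → HamCycle Q S
    HamCycle-map C = record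
      { len = len ; len≥3 = len≥3 ; w = σ ∘′ w ; inj = inj ∘′ σ-injective
      ; inP = λ i → P⇒Q (w i) (inP i) ; cover = σ-onto w cover ; adj = λ i → R⇒S (adj i) }
      where open HamCycle C

    HamPath-map : ∀ {s t} → HamPath P R s t → HamPath Q S (σ s) (σ t)
    HamPath-map Pth = record
      { k = k ; w = σ ∘′ w ; inj = inj ∘′ σ-injective
      ; inP = λ i → P⇒Q (w i) (inP i) ; cover = σ-onto w cover ; adj = λ i → R⇒S (adj i)
      ; start = cong σ start ; end = cong σ end }
      where open HamPath Pth

swap-uv : ∀ {m} → V m → V m
swap-uv (u i) = v i
swap-uv (v i) = u i

swap-uv-involutive : ∀ {m} (p : V m) → swap-uv (swap-uv p) ≡ p
swap-uv-involutive (u i) = refl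
swap-uv-involutive (v i) = refl

module _ {n : ℕ} (a b : Fin (suc n)) where

  open ℤ/suc n

  Λ-comm : ∀ {x} → Λ a b x → Λ b a x
  Λ-comm gen-a         = gen-b
  Λ-comm gen-b         = gen-a
  Λ-comm gen-0         = gen-0
  Λ-comm (gen-add p q) = gen-add (Λ-comm p) (Λ-comm q)
  Λ-comm (gen-neg p)   = gen-neg (Λ-comm p)

  InH0-swap-uv : ∀ p → InH0 a b p → InH0 b a (swap-uv p)
  InH0-swap-uv (u _) = Λ-comm
  InH0-swap-uv (v _) = Λ-comm

  H0Adj-swap-uv : ∀ {p q} → H0Adj a b p q → H0Adj b a (swap-uv p) (swap-uv q)
  H0Adj-swap-uv (inj₁ (outer x∈Λ)) = inj₁ (inner (Λ-comm x∈Λ))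
  H0Adj-swap-uv (inj₁ (inner x∈Λ)) = inj₁ (outer (Λ-comm x∈Λ))
  H0Adj-swap-uv (inj₁ (spoke x∈Λ)) = inj₂ (spoke (Λ-comm x∈Λ))
  H0Adj-swap-uv (inj₂ (outer x∈Λ)) = inj₂ (inner (Λ-comm x∈Λ))
  H0Adj-swap-uv (inj₂ (inner x∈Λ)) = inj₂ (outer (Λ-comm x∈Λ))
  H0Adj-swap-uv (inj₂ (spoke x∈Λ)) = inj₁ (spoke (Λ-comm x∈Λ))

  GAdj-swap-uv : ∀ c {p q} → GAdj a b c p q → GAdj b a (⊖ c) (swap-uv p) (swap-uv q)
  GAdj-swap-uv c = [ edge , swap ∘′ edge ]′
    where
    edge : ∀ {p q} → GEdge a b c p q → GAdj b a (⊖ c) (swap-uv p) (swap-uv q)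
    edge (outer i)  = inj₁ (inner i)
    edge (inner i)  = inj₁ (outer i)
    edge (spoke0 i) = inj₂ (spoke0 i)
    edge (spokec i) = inj₂ (subst (GEdge b a (⊖ c) (u (i ⊕ c)) ∘′ v) (//-rightDividesʳ c i) (spokec (i ⊕ c)))

hamiltonian-from-path : ∀ {n} (a b c : Fin (suc n)) → Connected (GAdj a b c) →
                        HamCycle (InH0 a b) (H0Adj a b) → HamPath (InH0 a b) (H0Adj a b) (v fzero) (v a) →
                        Hamiltonian (GAdj a b c)
hamiltonian-from-path a b c conn C P =
  let _ , walk , enum = HamPath⇒walk P in Splicing.hamiltonian a b c walk enum conn C

proposition14 : (m : ℕ) (a b c : Fin m) →
    3 ≤ m → toℕ a ≢ 0 → toℕ b ≢ 0 → toℕ c ≢ 0 →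
    2 * toℕ a ≢ m → 2 * toℕ b ≢ m →
    Connected (GAdj a b c) →
    1 < gcd (gcd m (toℕ a)) (toℕ b) →
    (C : HamCycle (InH0 a b) (H0Adj a b)) → TwoHooked a b C →
    Hamiltonian (GAdj a b c)
proposition14 (suc n) a b c _ _ _ _ _ _ conn _ C (_ , _ , _ , inj₁ (P , _)) = hamiltonian-from-path a b c conn C P
proposition14 (suc n) a b c _ _ _ _ _ _ conn _ C (_ , _ , _ , inj₂ (P , _)) =
  HamCycle-map swap-uv swap-uv-involutive swapped⇒G _ _ (hamiltonian-from-path b a (⊖ c) conn′ C′ P′)
  where
  open ℤ/suc n
  swapped⇒G : ∀ {p q} → GAdj b a (⊖ c) p q → GAdj a b c (swap-uv p) (swap-uv q)
  swapped⇒G = subst (λ c → GAdj a b c _ _) (⁻¹-involutive c) ∘′ GAdj-swap-uv b a (⊖ c)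
  conn′ : Connected (GAdj b a (⊖ c))
  conn′ = Connected-map swap-uv swap-uv-involutive (GAdj-swap-uv a b c) conn
  C′ : HamCycle (InH0 b a) (H0Adj b a)
  C′ = HamCycle-map swap-uv swap-uv-involutive (H0Adj-swap-uv a b) (InH0-swap-uv a b) (InH0-swap-uv b a) C
  P′ : HamPath (InH0 b a) (H0Adj b a) (v fzero) (v b)
  P′ = HamPath-map swap-uv swap-uv-involutive (H0Adj-swap-uv a b) (InH0-swap-uv a b) (InH0-swap-uv b a) P
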